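{- Let $t\ge2$, $k>t$, $v$ be positive integers and let $A$ be a $(1,t)$-DA$(N;k,v)$. Let $i\in\{1,\dots,k\}$ and let $v_i$ be an integer with $2\le v_i<v$. If $A$ is also a $(\lceil v/v_i\rceil,t)$-LA$(N;k,v)$, then a $(\bar{1},t)$-LA$(N;k,(v,\dots,v,v_i,v,\dots,v))$ exists, where the level vector has $v_i$ in position $i$ and $v$ in all other positions.
   Context: For positive integers $N,k,t$ with $t<k$ and $v_1,\dots,v_k$, consider $N\times k$ arrays $A=(a_{rj})$ whose $j$-th column has entries from a set $V_j$ with $|V_j|=v_j$ (for $(N;k,v)$ all $v_j=v$). A $t$-way interaction is $T=\{(j,\sigma_j):j\in I\}$ with $I\subseteq\{1,\dots,k\}$, $|I|=t$, $\sigma_j\in V_j$; $\rho(A,T)$ is the set of rows $r$ with $a_{rj}=\sigma_j$ for all $j\in I$, and $\rho(A,\mathcal T)=\bigcup_{T\in\mathcal T}\rho(A,T)$. Let $\mathcal I_t$ be the set of all $t$-way interactions. $A$ is a $(d,t)$-LA if for all $\mathcal T_1,\mathcal T_2\subseteq\mathcal I_t$ with $|\mathcal T_1|=|\mathcal T_2|=d$: $\rho(A,\mathcal T_1)=\rho(A,\mathcal T_2)\iff\mathcal T_1=\mathcal T_2$; it is a $(\bar d,t)$-LA if the same holds for all $\mathcal T_1,\mathcal T_2$ with $|\mathcal T_1|\le d$, $|\mathcal T_2|\le d$. $A$ is a $(d,t)$-detecting array, $(d,t)$-DA$(N;k,v)$, if for every $\mathcal T\subseteq\mathcal I_t$ with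 $|\mathcal T|=d$ and every $T\in\mathcal I_t$: $\rho(A,T)\subseteq\rho(A,\mathcal T)\iff T\in\mathcal T$. -}

module Defs where

open import Data.Nat using (ℕ; zero; suc; _+_; _<_; _≤_)
open import Data.Nat.DivMod using (_/_)
open import Data.Fin using (Fin)
open import Data.Maybe using (Maybe; just; nothing)
open import Data.Vec using (Vec; lookup)
open import Data.List using (List; length)
open import Data.List.Relation.Unary.Any using (Any)
open import Data.List.Relation.Unary.All using (All)
open import Data.List.Relation.Unary.Unique.Propositional using (Unique)
open import Data.List.Membership.Propositional using (_∈_)
open import Data.Product using (_×_)
open import Relation.Binary.PropositionalEquality using (_≡_)
open import Relation.Nullary using (yes; no)
open import Data.Fin using (_≟_)

-- Ceiling division ⌈ a / b ⌉ (for b ≥ 1; value 0 for b = 0, never used).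
ceilDiv : ℕ → ℕ → ℕ
ceilDiv a zero    = zero
ceilDiv a (suc b) = (a + b) / suc b

-- Level vector (v_1,…,v_k) as a function, column j has symbol set {0,…,v_j - 1}.
Levels : ℕ → Set
Levels k = Fin k → ℕ

Array : ℕ → ℕ → Set
Array N k = Fin N → Fin k → ℕ

WellFormed : ∀ {N k} → Levels k → Array N k → Set
WellFormed {N} {k} vs A = ∀ (r : Fin N) (j : Fin k) → A r j < vs j

-- An interaction: for each column either "not in I" (nothing) or the chosen symbol σ_j.
Interaction : ℕ → Set
Interaction k = Vec (Maybe ℕ) k

strength : ∀ {k} → Interaction k → ℕ
strength Data.Vec.[] = zero
strength (just _ Data.Vec.∷ T) = suc (strength T)
strength (nothing Data.Vec.∷ T) = strength T

IsTWay : ∀ {k} → ℕ → Levels k → Interaction k → Set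
IsTWay {k} t vs T = (strength T ≡ t) × (∀ (j : Fin k) σ → lookup T j ≡ just σ → σ < vs j)

-- a set of interactions: a duplicate-free list
InteractionSet : ℕ → Set
InteractionSet k = List (Interaction k)

IsTWaySet : ∀ {k} → ℕ → Levels k → InteractionSet k → Set
IsTWaySet t vs 𝒯 = Unique 𝒯 × All (IsTWay t vs) 𝒯

Covers : ∀ {N k} → Array N k → Fin N → Interaction k → Set
Covers {k = k} A r T = ∀ (j : Fin k) σ → lookup T j ≡ just σ → A r j ≡ σ

InRhoSet : ∀ {N k} → Array N k → Fin N → InteractionSet k → Set
InRhoSet A r 𝒯 = Any (Covers A r) 𝒯

_⇔_ : Set → Set → Set
P ⇔ Q = (P → Q) × (Q → P)
infix 3 _⇔_

SameRows : ∀ {N k} → Array N k → InteractionSet k → InteractionSet k → Set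
SameRows {N} A 𝒯₁ 𝒯₂ = ∀ (r : Fin N) → InRhoSet A r 𝒯₁ ⇔ InRhoSet A r 𝒯₂

RowsSubset : ∀ {N k} → Array N k → Interaction k → InteractionSet k → Set
RowsSubset {N} A T 𝒯 = ∀ (r : Fin N) → Covers A r T → InRhoSet A r 𝒯

SameSet : ∀ {k} → InteractionSet k → InteractionSet k → Set
SameSet {k} 𝒯₁ 𝒯₂ = ∀ (T : Interaction k) → T ∈ 𝒯₁ ⇔ T ∈ 𝒯₂

IsLA : ∀ {N k} → ℕ → ℕ → Levels k → Array N k → Set
IsLA d t vs A = ∀ 𝒯₁ 𝒯₂ → IsTWaySet t vs 𝒯₁ → IsTWaySet t vs 𝒯₂ →
  length 𝒯₁ ≡ d → length 𝒯₂ ≡ d → (SameRows A 𝒯₁ 𝒯₂ ⇔ SameSet 𝒯₁ 𝒯₂)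

IsLAbar : ∀ {N k} → ℕ → ℕ → Levels k → Array N k → Set
IsLAbar d t vs A = ∀ 𝒯₁ 𝒯₂ → IsTWaySet t vs 𝒯₁ → IsTWaySet t vs 𝒯₂ →
  length 𝒯₁ ≤ d → length 𝒯₂ ≤ d → (SameRows A 𝒯₁ 𝒯₂ ⇔ SameSet 𝒯₁ 𝒯₂)

IsDA : ∀ {N k} → ℕ → ℕ → Levels k → Array N k → Set
IsDA d t vs A = ∀ 𝒯 T → IsTWaySet t vs 𝒯 → length 𝒯 ≡ d → IsTWay t vs T →
  (RowsSubset A T 𝒯 ⇔ T ∈ 𝒯)

uniform : ∀ {k} → ℕ → Levels k
uniform v _ = v

oneChanged : ∀ {k} → ℕ → Fin k → ℕ → Levels k
oneChanged v i vi j with j ≟ i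
... | yes _ = vi
... | no _ = v

-- Reduce the symbols of column i modulo vᵢ. Every t-way interaction that is admissible for the
-- new levels is still covered by the rows that covered it in A, and on a row covering an
-- interaction that uses column i the reduction changes nothing. So equal row sets in the new
-- array give an inclusion of row sets in A, which the (1,t)-detecting property turns into
-- equality of the interactions; nonemptiness of row sets also comes from detection, applied to
-- an interaction and a perturbed copy of it.
module Submission where

open import Defs
open import Data.Nat using (ℕ; zero; suc; _≤_; _<_; z≤n; s≤s; >-nonZero)
open import Data.Nat.Properties using (≤-refl; ≤-trans; <-≤-trans; <⇒≤)
open import Data.Nat.DivMod using (_%_; m%n<n; m<n⇒m%n≡m)
open import Data.Fin using (Fin; _≟_) renaming (zero to fzero; suc to fsuc)
open import Data.Maybe using (just; nothing)
open import Data.Maybe.Properties using (just-injective)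
open import Data.Vec using ([]; _∷_; lookup)
open import Data.Vec.Properties using (∷-injectiveˡ; ∷-injectiveʳ)
open import Data.List using ([]; _∷_)
open import Data.List.Relation.Unary.Any using (here)
open import Data.List.Relation.Unary.Any.Properties using (¬Any[]; singleton⁻)
open import Data.List.Relation.Unary.All using ([]; _∷_)
open import Data.List.Relation.Unary.AllPairs using ([]; _∷_)
open import Data.Product using (Σ; _×_; _,_; proj₁; proj₂)
open import Data.Sum using (_⊎_; inj₁; inj₂)
open import Data.Empty using (⊥-elim)
open import Function using (id)
open import Relation.Nullary using (yes; no; ¬_)
open import Relation.Binary.PropositionalEquality using (_≡_; _≢_; refl; sym; trans; cong; subst)

private
  variable
    t k N : ℕ
    vs ws : Levels k
    A : Array N k

isTWay-mono : ∀ T → (∀ j → vs j ≤ ws j) → IsTWay t vs T → IsTWay t ws T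
isTWay-mono _ vs≤ws (str , bounded) = str , λ j σ eq → <-≤-trans (bounded j σ eq) (vs≤ws j)

toggle : ℕ → ℕ
toggle zero    = 1
toggle (suc _) = 0

toggle-<2 : ∀ x → toggle x < 2
toggle-<2 zero    = s≤s (s≤s z≤n)
toggle-<2 (suc _) = s≤s z≤n

toggle-≢ : ∀ x → toggle x ≢ x
toggle-≢ zero    ()
toggle-≢ (suc _) ()

toggleFirst : Interaction k → Interaction k
toggleFirst []             = []
toggleFirst (nothing ∷ T)  = nothing ∷ toggleFirst T
toggleFirst (just σ ∷ T)   = just (toggle σ) ∷ T

strength-toggleFirst : (T : Interaction k) → strength (toggleFirst T) ≡ strength T
strength-toggleFirst []            = refl
strength-toggleFirst (nothing ∷ T) = strength-toggleFirst T
strength-toggleFirst (just _ ∷ _)  = refl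

lookup-toggleFirst : (T : Interaction k) (j : Fin k) {σ : ℕ} →
  lookup (toggleFirst T) j ≡ just σ → σ < 2 ⊎ lookup T j ≡ just σ
lookup-toggleFirst (nothing ∷ T) fzero    ()
lookup-toggleFirst (nothing ∷ T) (fsuc j) eq = lookup-toggleFirst T j eq
lookup-toggleFirst (just σ ∷ T)  fzero    eq = inj₁ (subst (_< 2) (just-injective eq) (toggle-<2 σ))
lookup-toggleFirst (just σ ∷ T)  (fsuc j) eq = inj₂ eq

toggleFirst-≢ : (T : Interaction k) → 1 ≤ strength T → toggleFirst T ≢ T
toggleFirst-≢ (nothing ∷ T) 1≤str eq = toggleFirst-≢ T 1≤str (∷-injectiveʳ eq)
toggleFirst-≢ (just σ ∷ T)  _     eq = toggle-≢ σ (just-injective (∷-injectiveˡ eq))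

isTWay-toggleFirst : ∀ T → (∀ j → 2 ≤ vs j) → IsTWay t vs T → IsTWay t vs (toggleFirst T)
isTWay-toggleFirst T 2≤vs (str , bounded) =
  trans (strength-toggleFirst T) str , λ j σ eq → bound j (lookup-toggleFirst T j eq)
  where
  bound : ∀ j {σ} → σ < 2 ⊎ lookup T j ≡ just σ → σ < _
  bound j (inj₁ σ<2) = <-≤-trans σ<2 (2≤vs j)
  bound j (inj₂ eq)  = bounded j _ eq

module _ {vs : Levels k} {A : Array N k} (da : IsDA 1 t vs A) where

  detecting-⊆⇒≡ : ∀ T U → IsTWay t vs T → IsTWay t vs U →
    (∀ r → Covers A r T → Covers A r U) → T ≡ U
  detecting-⊆⇒≡ T U twT twU ⊆ =
    singleton⁻ (proj₁ (da (U ∷ []) _ (([] ∷ []) , (twU ∷ [])) refl twT) λ r c → here (⊆ r c))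

  -- An interaction covered by no row would be detected as a fault of its toggled copy.
  detecting-nonempty : ∀ T → (∀ j → 2 ≤ vs j) → 1 ≤ t → IsTWay t vs T → ¬ (∀ r → ¬ Covers A r T)
  detecting-nonempty T 2≤vs 1≤t twT empty =
    toggleFirst-≢ T (subst (1 ≤_) (sym (proj₁ twT)) 1≤t)
      (sym (detecting-⊆⇒≡ T (toggleFirst T) twT (isTWay-toggleFirst T 2≤vs twT)
                          λ r c → ⊥-elim (empty r c)))

laBar1-intro : {B : Array N k} →
  (∀ T → IsTWay t vs T → ¬ (∀ r → ¬ Covers B r T)) →
  (∀ T U → IsTWay t vs T → IsTWay t vs U → (∀ r → Covers B r T ⇔ Covers B r U) → T ≡ U) →
  IsLAbar 1 t vs B
laBar1-intro {B = B} nonempty separates = cases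
  where
  ≡⇒sameRows : ∀ {T U} → T ≡ U → SameRows B (T ∷ []) (U ∷ [])
  ≡⇒sameRows refl _ = id , id

  ≡⇒sameSet : ∀ {T U : Interaction _} → T ≡ U → SameSet (T ∷ []) (U ∷ [])
  ≡⇒sameSet refl _ = id , id

  sameRows⁻ : ∀ {T U} → SameRows B (T ∷ []) (U ∷ []) → ∀ r → Covers B r T ⇔ Covers B r U
  sameRows⁻ same r = (λ c → singleton⁻ (proj₁ (same r) (here c)))
                   , (λ c → singleton⁻ (proj₂ (same r) (here c)))

  empty≢singleton : ∀ U → IsTWay _ _ U →
      (SameRows B [] (U ∷ []) ⇔ SameSet [] (U ∷ []))
    × (SameRows B (U ∷ []) [] ⇔ SameSet (U ∷ []) [])
  empty≢singleton U twU =
      ((λ same → ⊥-elim (nonempty U twU λ r c → ¬Any[] (proj₂ (same r) (here c))))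
    , (λ same → ⊥-elim (¬Any[] (proj₂ (same _) (here refl)))))
    , ((λ same → ⊥-elim (nonempty U twU λ r c → ¬Any[] (proj₁ (same r) (here c))))
    , (λ same → ⊥-elim (¬Any[] (proj₁ (same _) (here refl)))))

  cases : IsLAbar 1 _ _ _
  cases []       []       _ _ _ _ = (λ _ _ → id , id) , (λ _ _ → id , id)
  cases []       (U ∷ []) _ (_ , (twU ∷ [])) _ _ = proj₁ (empty≢singleton U twU)
  cases (T ∷ []) []       (_ , (twT ∷ [])) _ _ _ = proj₂ (empty≢singleton T twT)
  cases (T ∷ []) (U ∷ []) (_ , (twT ∷ [])) (_ , (twU ∷ [])) _ _ =
      (λ same → ≡⇒sameSet (separates T U twT twU (sameRows⁻ same)))
    , (λ same → ≡⇒sameRows (singleton⁻ (proj₁ (same T) (here refl))))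
  cases []          (_ ∷ _ ∷ _) _ _ _ (s≤s ())
  cases (_ ∷ [])    (_ ∷ _ ∷ _) _ _ _ (s≤s ())
  cases (_ ∷ _ ∷ _) _           _ _ (s≤s ()) _

mapColumn : Fin k → (ℕ → ℕ) → Array N k → Array N k
mapColumn i f A r j with j ≟ i
... | yes _ = f (A r j)
... | no  _ = A r j

module _ {i : Fin k} {f : ℕ → ℕ} {A : Array N k} {r : Fin N} where

  covers-mapColumn : ∀ T → (∀ σ → lookup T i ≡ just σ → f σ ≡ σ) →
    Covers A r T → Covers (mapColumn i f A) r T
  covers-mapColumn T fixes c j σ eq with j ≟ i
  ... | yes refl = trans (cong f (c i σ eq)) (fixes σ eq)
  ... | no  _    = c j σ eq

  covers-mapColumn⁻ : ∀ U → (∀ σ → lookup U i ≡ just σ → f (A r i) ≡ A r i) →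
    Covers (mapColumn i f A) r U → Covers A r U
  covers-mapColumn⁻ U unchanged c j σ eq with j ≟ i | c j σ eq
  ... | yes refl | fAri≡σ = trans (sym (unchanged σ eq)) fAri≡σ
  ... | no  _    | Arj≡σ  = Arj≡σ

mapColumn-wellFormed : {i : Fin k} {f : ℕ → ℕ} → WellFormed vs A →
  (∀ j → j ≢ i → vs j ≤ ws j) → (∀ x → f x < ws i) → WellFormed ws (mapColumn i f A)
mapColumn-wellFormed {A = A} {i = i} wf vs≤ws f<ws r j with j ≟ i
... | yes refl = f<ws (A r i)
... | no  j≢i  = <-≤-trans (wf r j) (vs≤ws j j≢i)

module _ {vs ws : Levels k} {A : Array N k} (da : IsDA 1 t vs A) (ws≤vs : ∀ j → ws j ≤ vs j)
         (i : Fin k) (f : ℕ → ℕ) (fixes : ∀ σ → σ < ws i → f σ ≡ σ) where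

  private
    fixesAt : ∀ T → IsTWay t ws T → ∀ σ → lookup T i ≡ just σ → f σ ≡ σ
    fixesAt _ (_ , bounded) σ eq = fixes σ (bounded i σ eq)

    isTWay-vs : ∀ T → IsTWay t ws T → IsTWay t vs T
    isTWay-vs T = isTWay-mono T ws≤vs

    nothing≢just : ∀ {σ : ℕ} → nothing ≢ just σ
    nothing≢just ()

    unchangedAt : ∀ T {r τ} → IsTWay t ws T → Covers A r T → lookup T i ≡ just τ →
      f (A r i) ≡ A r i
    unchangedAt T twT c eq =
      trans (cong f (c i _ eq)) (trans (fixesAt T twT _ eq) (sym (c i _ eq)))

  mapColumn-nonempty : (∀ j → 2 ≤ vs j) → 1 ≤ t →
    ∀ T → IsTWay t ws T → ¬ (∀ r → ¬ Covers (mapColumn i f A) r T)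
  mapColumn-nonempty 2≤vs 1≤t T twT empty =
    detecting-nonempty da T 2≤vs 1≤t (isTWay-vs T twT)
      λ r c → empty r (covers-mapColumn T (fixesAt T twT) c)

  -- Orient the pair so that the source interaction uses column i whenever the target does;
  -- then the rows covering the source in A are left unchanged by f.
  mapColumn-separates : ∀ T U → IsTWay t ws T → IsTWay t ws U →
    (∀ r → Covers (mapColumn i f A) r T ⇔ Covers (mapColumn i f A) r U) → T ≡ U
  mapColumn-separates T U twT twU same with lookup T i in eqT
  ... | just τ  = detecting-⊆⇒≡ da T U (isTWay-vs T twT) (isTWay-vs U twU) λ r c →
        covers-mapColumn⁻ U (λ _ _ → unchangedAt T twT c eqT)
          (proj₁ (same r) (covers-mapColumn T (fixesAt T twT) c))
  ... | nothing = sym (detecting-⊆⇒≡ da U T (isTWay-vs U twU) (isTWay-vs T twT) λ r c →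
        covers-mapColumn⁻ T (λ _ eq → ⊥-elim (nothing≢just (trans (sym eqT) eq)))
          (proj₂ (same r) (covers-mapColumn U (fixesAt U twU) c)))

module _ {v : ℕ} {i : Fin k} {vi : ℕ} where

  oneChanged-≡ : oneChanged v i vi i ≡ vi
  oneChanged-≡ with i ≟ i
  ... | yes _  = refl
  ... | no i≢i = ⊥-elim (i≢i refl)

  oneChanged-≢ : ∀ {j} → j ≢ i → oneChanged v i vi j ≡ v
  oneChanged-≢ {j} j≢i with j ≟ i
  ... | yes j≡i = ⊥-elim (j≢i j≡i)
  ... | no  _   = refl

  oneChanged-≤ : vi ≤ v → ∀ j → oneChanged v i vi j ≤ v
  oneChanged-≤ vi≤v j with j ≟ i
  ... | yes _ = vi≤v
  ... | no  _ = ≤-refl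

mainTheorem18 : (t k v N : ℕ) → 2 ≤ t → t < k → 1 ≤ v →
    (A : Array N k) → WellFormed (uniform v) A → IsDA 1 t (uniform v) A →
    (i : Fin k) (vi : ℕ) → 2 ≤ vi → vi < v →
    IsLA (ceilDiv v vi) t (uniform v) A →
    Σ (Array N k) (λ B → WellFormed (oneChanged v i vi) B × IsLAbar 1 t (oneChanged v i vi) B)
mainTheorem18 t k v N 2≤t _ _ A wf da i vi 2≤vi vi<v _ =
  B , wfB , laBar1-intro
    (mapColumn-nonempty da ws≤v i (_% vi) fixes (λ _ → 2≤v) (≤-trans (s≤s z≤n) 2≤t))
    (mapColumn-separates da ws≤v i (_% vi) fixes)
  where
  instance _ = >-nonZero (≤-trans (s≤s z≤n) 2≤vi)

  B : Array N k
  B = mapColumn i (_% vi) A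

  2≤v : 2 ≤ v
  2≤v = ≤-trans 2≤vi (<⇒≤ vi<v)

  ws≤v : ∀ j → oneChanged v i vi j ≤ v
  ws≤v = oneChanged-≤ (<⇒≤ vi<v)

  fixes : ∀ σ → σ < oneChanged v i vi i → σ % vi ≡ σ
  fixes σ σ<ws = m<n⇒m%n≡m (subst (σ <_) (oneChanged-≡ {v = v} {i}) σ<ws)

  wfB : WellFormed (oneChanged v i vi) B
  wfB = mapColumn-wellFormed wf (λ j j≢i → subst (v ≤_) (sym (oneChanged-≢ j≢i)) ≤-refl)
          (λ x → subst (x % vi <_) (sym (oneChanged-≡ {v = v} {i})) (m%n<n x vi))
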